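{- Every HyperLTL formula of the form $\varphi=\forall\pi\exists\pi_1\ldots\exists\pi_m\mathpunct{.}\phi$, where $\phi$ (read as an LTL formula over $\mathit{AP}_{\pi}\cup\mathit{AP}_{\pi_1}\cup\cdots\cup\mathit{AP}_{\pi_m}$) is a deterministic liveness property, is satisfiable and has a finite model, i.e., there is a non-empty finite set of traces $T$ with $T\models\varphi$.
   Context: Fix a finite set $\mathit{AP}$ of atomic propositions and $\Sigma=2^{\mathit{AP}}$; traces are elements of $\Sigma^\omega$; $\mathit{AP}_\pi=\{a_\pi\mid a\in\mathit{AP}\}$. HyperLTL: $\varphi ::= \exists\pi\mathpunct{.}\varphi \mid \forall\pi\mathpunct{.}\varphi \mid \phi$, $\phi ::= a_\pi \mid \neg\phi\mid\phi\wedge\phi\mid\mathsf{X}\phi\mid\phi\,\mathsf{U}\,\phi$ (closed); semantics w.r.t. a set of traces $T$: $a_\pi$ holds iff $a$ is in the current letter of the trace bound to $\pi$, temporal operators shift all bound traces synchronously, quantifiers range over $T$. A trace property $P$ is liveness if every finite word is a prefix of some trace in $P$. An LTL property is a deterministic liveness property if it is a liveness property and is recognized by a deterministic Büchi automaton. -}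

module Defs where

open import Data.Nat using (ℕ; zero; suc; _+_; _≤_; _<_)
open import Data.Fin using (Fin; toℕ)
open import Data.Fin.Subset using (Subset; _∈_)
open import Data.Vec using (Vec; []; _∷ʳ_) renaming (lookup to vlookup; map to vmap)
open import Data.List using (List; length) renaming (lookup to llookup)
open import Data.Product using (_×_; ∃; Σ)
open import Relation.Nullary using (¬_)
open import Relation.Binary.PropositionalEquality using (_≡_)
open import Function.Bundles using (_⇔_)

-- Atomic propositions AP = Fin n; letters Σ = 2^AP = Subset n.
-- Traces: infinite words over Σ.
Trace : ℕ → Set
Trace n = ℕ → Subset n

Word : Set → Set
Word A = ℕ → A

-- Quantifier-free bodies: LTL over AP_{π_0} ∪ ... ∪ AP_{π_{k-1}}.
-- (atom π a) is a_π.  A letter of the combined alphabet 2^(⋃ AP_π)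
-- is a k-tuple of letters of Σ, i.e. Vec (Subset n) k.

data LTL (k n : ℕ) : Set where
  atom : Fin k → Fin n → LTL k n
  ¬ₗ_  : LTL k n → LTL k n
  _∧ₗ_ : LTL k n → LTL k n → LTL k n
  Xₗ_  : LTL k n → LTL k n
  _Uₗ_ : LTL k n → LTL k n → LTL k n

_,_⊨_ : ∀ {k n} → Word (Vec (Subset n) k) → ℕ → LTL k n → Set
w , i ⊨ atom π a = a ∈ vlookup (w i) π
w , i ⊨ (¬ₗ φ)   = ¬ (w , i ⊨ φ)
w , i ⊨ (φ ∧ₗ ψ) = (w , i ⊨ φ) × (w , i ⊨ ψ)
w , i ⊨ (Xₗ φ)   = w , suc i ⊨ φ
w , i ⊨ (φ Uₗ ψ) =
  ∃ λ j → i ≤ j × (w , j ⊨ ψ) × (∀ l → i ≤ l → l < j → w , l ⊨ φ)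

⟦_⟧ₗ : ∀ {k n} → LTL k n → Word (Vec (Subset n) k) → Set
⟦ φ ⟧ₗ w = w , 0 ⊨ φ

_IsPrefixOf_ : ∀ {A : Set} → List A → Word A → Set
u IsPrefixOf w = ∀ (i : Fin (length u)) → llookup u i ≡ w (toℕ i)

IsLiveness : ∀ {A : Set} → (Word A → Set) → Set
IsLiveness {A} P = ∀ (u : List A) → ∃ λ w → P w × u IsPrefixOf w

record DBA (A : Set) : Set where
  field
    nStates : ℕ
    init    : Fin nStates
    δ       : Fin nStates → A → Fin nStates
    accept  : Subset nStates

  run : Word A → ℕ → Fin nStates
  run w zero    = init
  run w (suc i) = δ (run w i) (w i)

  Accepts : Word A → Set
  Accepts w = ∀ i → ∃ λ j → i ≤ j × run w j ∈ accept

Recognizes : ∀ {A : Set} → DBA A → (Word A → Set) → Set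
Recognizes {A} D P = ∀ (w : Word A) → P w ⇔ DBA.Accepts D w

IsDeterministicLiveness : ∀ {k n} → LTL k n → Set
IsDeterministicLiveness {k} {n} φ =
  IsLiveness ⟦ φ ⟧ₗ × Σ (DBA (Vec (Subset n) k)) (λ D → Recognizes D ⟦ φ ⟧ₗ)

-- HyperLTL: quantifier prefix over a body; k = number of bound trace
-- variables so far.  A newly quantified variable gets the next index
-- (the first quantified variable has index 0).

data HyperLTL (n : ℕ) : ℕ → Set where
  ∃ₕ_  : ∀ {k} → HyperLTL n (suc k) → HyperLTL n k
  ∀ₕ_  : ∀ {k} → HyperLTL n (suc k) → HyperLTL n k
  body : ∀ {k} → LTL k n → HyperLTL n k

zipTraces : ∀ {n k} → Vec (Trace n) k → Word (Vec (Subset n) k)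
zipTraces Π i = vmap (λ t → t i) Π

Sat : ∀ {n k} → (Trace n → Set) → Vec (Trace n) k → HyperLTL n k → Set
Sat T Π (∃ₕ φ)   = ∃ λ t → T t × Sat T (Π ∷ʳ t) φ
Sat T Π (∀ₕ φ)   = ∀ t → T t → Sat T (Π ∷ʳ t) φ
Sat T Π (body φ) = ⟦ φ ⟧ₗ (zipTraces Π)

_⊨ₕ_ : ∀ {n} → (Trace n → Set) → HyperLTL n 0 → Set
T ⊨ₕ φ = Sat T [] φ

∃* : ∀ {n} (m : ℕ) {k : ℕ} → HyperLTL n (m + k) → HyperLTL n k
∃* zero    ψ = ψ
∃* (suc m) ψ = ∃* m (∃ₕ ψ)

ListSet : ∀ {n} → List (Trace n) → Trace n → Set
ListSet ts t = Data.List.Membership.Propositional._∈_ t ts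
  where import Data.List.Membership.Propositional

-- Fix a deterministic Büchi automaton D for φ, read over letters listing (π, π₁, …, πₘ). Liveness
-- lets every finite word be extended until D reaches an accepting state. Build m + 1 traces
-- t₀, …, tₘ in rounds: in round k, with j = k mod (m + 1), read the prefix built so far under the
-- assignment π ↦ tⱼ (the remaining traces bound to π₁, …, πₘ in a fixed order) and extend it until D
-- accepts. Every assignment is served infinitely often, so in the limit D accepts all of them; thus
-- whichever tⱼ is chosen for π, the other traces witness the existential quantifiers.
module Submission where

open import Defs
open import Data.Nat using (ℕ; zero; suc; _+_; _*_; _≤_; _<_; _≤′_; ≤′-refl; ≤′-step; z≤n; s≤s)
open import Data.Nat.Properties
  using (≤-trans; ≤-total; n≤1+n; ≤⇒≤′; m≤n⇒∃[o]m+o≡n; m≤m*n; m≤n+m; module ≤-Reasoning)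
open import Data.Nat.DivMod using (_%_; _mod_; [m+kn]%n≡m%n; m<n⇒m%n≡m)
open import Data.Fin using (Fin; zero; suc; toℕ)
open import Data.Fin.Properties using (toℕ-injective; toℕ-fromℕ<; toℕ<n)
open import Data.Fin.Permutation.Components using (transpose; transpose-inverse)
open import Data.Fin.Subset using (Subset; ⊥) renaming (_∈_ to _∈ₛ_)
open import Data.List as List using (List; []; _∷_; _++_; length; foldl; applyUpTo)
open import Data.List.Properties
  using ( ++-assoc; ++-identityʳ; length-++-≤ˡ; length-++-sucʳ; foldl-∷ʳ
        ; applyUpTo-∷ʳ; map-applyUpTo; map-++; map-∘; map-cong; map-id)
open import Data.List.Membership.Propositional.Properties using (∈-tabulate⁺; ∈-tabulate⁻)
open import Data.Vec as Vec using (Vec; []; _∷_; _∷ʳ_; tabulate; lookup; initLast)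
open import Data.Vec.Properties using (map-∷ʳ; tabulate-∘; tabulate-cong; tabulate∘lookup)
open import Data.Vec.Relation.Unary.All using (All; []; _∷_)
open import Data.Vec.Relation.Unary.All.Properties using (tabulate⁺)
open import Data.Product using (∃; _×_; _,_; proj₁; proj₂)
open import Data.Sum using (inj₁; inj₂)
open import Function using (_∘_; id)
open import Function.Bundles using (Equivalence)
open import Relation.Nullary using (¬_)
open import Relation.Binary.PropositionalEquality
  using (_≡_; _≗_; refl; sym; trans; cong; cong₂; subst; module ≡-Reasoning)

⊨-resp-≗ : ∀ {k n} {w w′ : Word (Vec (Subset n) k)} →
           w ≗ w′ → ∀ φ i → w , i ⊨ φ → w′ , i ⊨ φ
⊨-resp-≗ w≗w′ (atom π a) i a∈ = subst (λ v → a ∈ₛ lookup v π) (w≗w′ i) a∈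
⊨-resp-≗ w≗w′ (¬ₗ φ)     i ¬φ = ¬φ ∘ ⊨-resp-≗ (sym ∘ w≗w′) φ i
⊨-resp-≗ w≗w′ (φ ∧ₗ ψ)   i (φ✓ , ψ✓) = ⊨-resp-≗ w≗w′ φ i φ✓ , ⊨-resp-≗ w≗w′ ψ i ψ✓
⊨-resp-≗ w≗w′ (Xₗ φ)     i φ✓ = ⊨-resp-≗ w≗w′ φ (suc i) φ✓
⊨-resp-≗ w≗w′ (φ Uₗ ψ)   i (j , i≤j , ψ✓ , φ✓) =
  j , i≤j , ⊨-resp-≗ w≗w′ ψ j ψ✓ , λ l i≤l l<j → ⊨-resp-≗ w≗w′ φ l (φ✓ l i≤l l<j)

module _ {A : Set} where

  applyUpTo-+ : ∀ (w : Word A) a b →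
                applyUpTo w (a + b) ≡ applyUpTo w a ++ applyUpTo (w ∘ (a +_)) b
  applyUpTo-+ w zero    b = refl
  applyUpTo-+ w (suc a) b = cong (w 0 ∷_) (applyUpTo-+ (w ∘ suc) a b)

  applyUpTo-prefix : ∀ (u : List A) (w : Word A) → u IsPrefixOf w → applyUpTo w (length u) ≡ u
  applyUpTo-prefix []      w u⊑w = refl
  applyUpTo-prefix (a ∷ u) w u⊑w =
    cong₂ _∷_ (sym (u⊑w zero)) (applyUpTo-prefix u (w ∘ suc) (u⊑w ∘ suc))

  pad : A → List A → Word A
  pad a []      p       = a
  pad a (x ∷ u) zero    = x
  pad a (x ∷ u) (suc p) = pad a u p

  pad-++ : ∀ a u v {p} → p < length u → pad a (u ++ v) p ≡ pad a u p
  pad-++ a (x ∷ u) v {zero}  _         = refl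
  pad-++ a (x ∷ u) v {suc p} (s≤s p<u) = pad-++ a u v p<u

  applyUpTo-pad : ∀ a u → applyUpTo (pad a u) (length u) ≡ u
  applyUpTo-pad a []      = refl
  applyUpTo-pad a (x ∷ u) = cong (x ∷_) (applyUpTo-pad a u)

  applyUpTo-cong : ∀ {w w′ : Word A} n → (∀ {p} → p < n → w p ≡ w′ p) →
                   applyUpTo w n ≡ applyUpTo w′ n
  applyUpTo-cong zero    w≗w′ = refl
  applyUpTo-cong (suc n) w≗w′ = cong₂ _∷_ (w≗w′ (s≤s z≤n)) (applyUpTo-cong n (w≗w′ ∘ s≤s))

module Limit {A : Set} (a₀ : A) (grow : ℕ → List A → List A) where

  chain : ℕ → List A
  chain zero    = []
  chain (suc n) = chain n ++ a₀ ∷ grow n (chain n)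

  limit : Word A
  limit p = pad a₀ (chain (suc p)) p

  n≤length-chain : ∀ n → n ≤ length (chain n)
  n≤length-chain zero    = z≤n
  n≤length-chain (suc n) = begin
    suc n                                    ≤⟨ s≤s (n≤length-chain n) ⟩
    suc (length (chain n))                   ≤⟨ s≤s (length-++-≤ˡ (chain n)) ⟩
    suc (length (chain n ++ grow n (chain n))) ≡⟨ length-++-sucʳ (chain n) a₀ (grow n (chain n)) ⟨
    length (chain (suc n))                   ∎
    where open ≤-Reasoning

  chain-extends : ∀ {m n} → m ≤′ n → ∃ λ v → chain n ≡ chain m ++ v
  chain-extends {m} ≤′-refl = [] , sym (++-identityʳ (chain m))
  chain-extends {m} (≤′-step {n} m≤′n) with chain-extends m≤′n
  ... | v , chain-n≡ = v ++ e , (begin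
      chain n ++ e         ≡⟨ cong (_++ e) chain-n≡ ⟩
      (chain m ++ v) ++ e  ≡⟨ ++-assoc (chain m) v e ⟩
      chain m ++ (v ++ e)  ∎)
    where
    open ≡-Reasoning
    e = a₀ ∷ grow n (chain n)

  limit-agrees : ∀ n {p} → p < length (chain n) → limit p ≡ pad a₀ (chain n) p
  limit-agrees n {p} p<n with ≤-total n (suc p)
  ... | inj₁ n≤1+p = let v , eq = chain-extends (≤⇒≤′ n≤1+p) in
    trans (cong (λ u → pad a₀ u p) eq) (pad-++ a₀ (chain n) v p<n)
  ... | inj₂ 1+p≤n = let v , eq = chain-extends (≤⇒≤′ 1+p≤n) in
    sym (trans (cong (λ u → pad a₀ u p) eq) (pad-++ a₀ (chain (suc p)) v (n≤length-chain (suc p))))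

  applyUpTo-limit : ∀ n → applyUpTo limit (length (chain n)) ≡ chain n
  applyUpTo-limit n =
    trans (applyUpTo-cong (length (chain n)) (limit-agrees n)) (applyUpTo-pad a₀ (chain n))

module _ {A : Set} (D : DBA A) where
  open DBA D

  δ* : List A → Fin nStates
  δ* = foldl δ init

  run-applyUpTo : ∀ w j → run w j ≡ δ* (applyUpTo w j)
  run-applyUpTo w zero    = refl
  run-applyUpTo w (suc j) = begin
    δ (run w j) (w j)                     ≡⟨ cong (λ q → δ q (w j)) (run-applyUpTo w j) ⟩
    δ (δ* (applyUpTo w j)) (w j)          ≡⟨ foldl-∷ʳ δ init (w j) (applyUpTo w j) ⟨
    δ* (applyUpTo w j List.∷ʳ w j)        ≡⟨ cong δ* (applyUpTo-∷ʳ w j) ⟩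
    δ* (applyUpTo w (suc j))              ∎
    where open ≡-Reasoning

  Live : Set
  Live = ∀ u → ∃ λ v → δ* (u ++ v) ∈ₛ accept

  liveness⇒Live : ∀ {P} → IsLiveness P → Recognizes D P → Live
  liveness⇒Live liveness recognizes u =
    let w , Pw , u⊑w   = liveness u
        j , u≤j , acc  = Equivalence.to (recognizes w) Pw (length u)
        d , u+d≡j      = m≤n⇒∃[o]m+o≡n u≤j
        v              = applyUpTo (w ∘ (length u +_)) d
        run≡ : run w j ≡ δ* (u ++ v)
        run≡ = begin
          run w j                                         ≡⟨ run-applyUpTo w j ⟩
          δ* (applyUpTo w j)                              ≡⟨ cong (δ* ∘ applyUpTo w) u+d≡j ⟨
          δ* (applyUpTo w (length u + d))                 ≡⟨ cong δ* (applyUpTo-+ w (length u) d) ⟩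
          δ* (applyUpTo w (length u) ++ v)                ≡⟨ cong (δ* ∘ (_++ v)) (applyUpTo-prefix u w u⊑w) ⟩
          δ* (u ++ v)                                     ∎
    in v , subst (_∈ₛ accept) run≡ acc
    where open ≡-Reasoning

module _ {A B I : Set} (D : DBA A) (live : Live D)
         (view : I → B → A) (lift : I → A → B) (view∘lift : ∀ i → view i ∘ lift i ≗ id)
         (b₀ : B) (schedule : ℕ → I) where
  open DBA D

  private
    grow : ℕ → List B → List B
    grow n u = List.map (lift (schedule n)) (proj₁ (live (List.map (view (schedule n)) (u List.∷ʳ b₀))))

    open Limit b₀ grow

    δ*-view-chain : ∀ n → δ* D (List.map (view (schedule n)) (chain (suc n))) ∈ₛ accept
    δ*-view-chain n = subst (λ u → δ* D u ∈ₛ accept) (sym map-chain≡) (proj₂ (live u))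
      where
      open ≡-Reasoning
      i = schedule n
      u = List.map (view i) (chain n List.∷ʳ b₀)
      v = proj₁ (live u)
      map-chain≡ : List.map (view i) (chain (suc n)) ≡ u ++ v
      map-chain≡ = begin
        List.map (view i) (chain n ++ b₀ ∷ List.map (lift i) v)
          ≡⟨ map-++ (view i) (chain n) _ ⟩
        List.map (view i) (chain n) ++ view i b₀ ∷ List.map (view i) (List.map (lift i) v)
          ≡⟨ cong (λ x → List.map (view i) (chain n) ++ view i b₀ ∷ x) (map-view∘lift v) ⟩
        List.map (view i) (chain n) ++ List.[ view i b₀ ] ++ v
          ≡⟨ ++-assoc (List.map (view i) (chain n)) List.[ view i b₀ ] v ⟨
        (List.map (view i) (chain n) ++ List.[ view i b₀ ]) ++ v
          ≡⟨ cong (_++ v) (map-++ (view i) (chain n) List.[ b₀ ]) ⟨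
        u ++ v ∎
        where
        map-view∘lift : ∀ v → List.map (view i) (List.map (lift i) v) ≡ v
        map-view∘lift v = trans (sym (map-∘ v)) (trans (map-cong (view∘lift i) v) (map-id v))

  accepted-in-all-views : (∀ i r → ∃ λ k → r ≤ k × schedule k ≡ i) →
                          ∃ λ (g : Word B) → ∀ i → Accepts (view i ∘ g)
  accepted-in-all-views fair = limit , accepts
    where
    accepts : ∀ i → Accepts (view i ∘ limit)
    accepts i r with fair i r
    ... | k , r≤k , refl =
      length (chain (suc k)) , ≤-trans r≤k (≤-trans (n≤1+n k) (n≤length-chain (suc k))) ,
      subst (_∈ₛ accept) (sym run≡) (δ*-view-chain k)
      where
      open ≡-Reasoning
      j = length (chain (suc k))
      run≡ : run (view i ∘ limit) j ≡ δ* D (List.map (view i) (chain (suc k)))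
      run≡ = begin
        run (view i ∘ limit) j                       ≡⟨ run-applyUpTo D (view i ∘ limit) j ⟩
        δ* D (applyUpTo (view i ∘ limit) j)          ≡⟨ cong (δ* D) (map-applyUpTo limit (view i) j) ⟨
        δ* D (List.map (view i) (applyUpTo limit j)) ≡⟨ cong (δ* D ∘ List.map (view i)) (applyUpTo-limit (suc k)) ⟩
        δ* D (List.map (view i) (chain (suc k)))     ∎

mod-fair : ∀ {K} (i : Fin (suc K)) r → ∃ λ k → r ≤ k × k mod suc K ≡ i
mod-fair {K} i r = k , r≤k , toℕ-injective (begin
    toℕ (k mod suc K)  ≡⟨ toℕ-fromℕ< _ ⟩
    k % suc K          ≡⟨ [m+kn]%n≡m%n (toℕ i) r (suc K) ⟩
    toℕ i % suc K      ≡⟨ m<n⇒m%n≡m (toℕ<n i) ⟩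
    toℕ i              ∎)
  where
  open ≡-Reasoning
  k = toℕ i + r * suc K
  r≤k : r ≤ k
  r≤k = ≤-trans (m≤m*n r (suc K)) (m≤n+m (r * suc K) (toℕ i))

-- Π ++ reverse W: the witnesses W of ∃* are listed innermost quantifier first.
_++ʳ_ : ∀ {X : Set} {k m} → Vec X k → Vec X m → Vec X (m + k)
Π ++ʳ []      = Π
Π ++ʳ (w ∷ W) = (Π ++ʳ W) ∷ʳ w

map-++ʳ : ∀ {X Y : Set} (f : X → Y) {k m} (Π : Vec X k) (W : Vec X m) →
          Vec.map f (Π ++ʳ W) ≡ Vec.map f Π ++ʳ Vec.map f W
map-++ʳ f Π []      = refl
map-++ʳ f Π (w ∷ W) = trans (map-∷ʳ f w (Π ++ʳ W)) (cong (_∷ʳ f w) (map-++ʳ f Π W))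

toPrefixOrder : ∀ {X : Set} {m} → Vec X (suc m) → Vec X (m + 1)
toPrefixOrder (x ∷ W) = (x ∷ []) ++ʳ W

toPrefixOrder-surjective : ∀ {X : Set} m (a : Vec X (m + 1)) → ∃ λ v → toPrefixOrder v ≡ a
toPrefixOrder-surjective zero    (x ∷ []) = x ∷ [] , refl
toPrefixOrder-surjective (suc m) a with initLast a
... | a′ , y , refl with toPrefixOrder-surjective m a′
...   | x ∷ W , eq = x ∷ y ∷ W , cong (_∷ʳ y) eq

Sat-∃* : ∀ {n} {T : Trace n → Set} m {k} {Π : Vec (Trace n) k} {ψ : HyperLTL n (m + k)}
         (W : Vec (Trace n) m) → All T W → Sat T (Π ++ʳ W) ψ → Sat T Π (∃* m ψ)
Sat-∃* zero    []      []        sat = sat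
Sat-∃* (suc m) (w ∷ W) (Tw ∷ TW) sat = Sat-∃* m W TW (w , Tw , sat)

module _ {m : ℕ} where

  -- Entry j of b is bound to π; the transposition fixes an order of the others for π₁, …, πₘ.
  view : ∀ {X : Set} → Fin (suc m) → (Fin (suc m) → X) → Vec X (m + 1)
  view j b = toPrefixOrder (tabulate (b ∘ transpose zero j))

  lift : ∀ {X : Set} → Fin (suc m) → Vec X (m + 1) → (Fin (suc m) → X)
  lift j a = lookup (proj₁ (toPrefixOrder-surjective m a)) ∘ transpose j zero

  view∘lift : ∀ {X : Set} j → view {X} j ∘ lift j ≗ id
  view∘lift j a = begin
    view j (lift j a)
      ≡⟨ cong toPrefixOrder (tabulate-cong (λ i → cong (lookup v) (transpose-inverse j zero {i}))) ⟩
    toPrefixOrder (tabulate (lookup v))  ≡⟨ cong toPrefixOrder (tabulate∘lookup v) ⟩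
    toPrefixOrder v                      ≡⟨ proj₂ (toPrefixOrder-surjective m a) ⟩
    a                                    ∎
    where
    open ≡-Reasoning
    v = proj₁ (toPrefixOrder-surjective m a)

  map-view : ∀ {X Y : Set} (f : X → Y) j b → Vec.map f (view j b) ≡ view j (f ∘ b)
  map-view f j b = begin
    Vec.map f (view j b)                         ≡⟨ map-++ʳ f (b j ∷ []) (tabulate (b ∘ τ ∘ suc)) ⟩
    (f (b j) ∷ []) ++ʳ Vec.map f (tabulate (b ∘ τ ∘ suc))
      ≡⟨ cong ((f (b j) ∷ []) ++ʳ_) (tabulate-∘ f (b ∘ τ ∘ suc)) ⟨
    view j (f ∘ b)                               ∎
    where
    open ≡-Reasoning
    τ = transpose zero j

proposition4p14 : ∀ (n m : ℕ) (φ : LTL (m + 1) n) →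
    IsDeterministicLiveness φ →
    ∃ λ (ts : List (Trace n)) →
      (¬ ts ≡ []) × (ListSet ts ⊨ₕ (∀ₕ (∃* m (body φ))))
proposition4p14 n m φ (liveness , D , recognizes) = List.tabulate t , (λ ()) , satisfies
  where
  word-accepted : ∃ λ (g : Word (Fin (suc m) → Subset n)) → ∀ j → DBA.Accepts D (view j ∘ g)
  word-accepted = accepted-in-all-views D (liveness⇒Live D liveness recognizes)
                  view lift view∘lift (λ _ → ⊥) (_mod suc m) mod-fair

  t : Fin (suc m) → Trace n
  t j p = proj₁ word-accepted p j

  satisfies : ListSet (List.tabulate t) ⊨ₕ (∀ₕ (∃* m (body φ)))
  satisfies t′ t′∈ with ∈-tabulate⁻ {f = t} t′∈
  ... | j , refl =
    Sat-∃* m (tabulate (t ∘ transpose zero j ∘ suc)) (tabulate⁺ (λ _ → ∈-tabulate⁺ {f = t} _))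
      (⊨-resp-≗ (λ p → sym (map-view (λ tr → tr p) j t)) φ 0
        (Equivalence.from (recognizes _) (proj₂ word-accepted j)))
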